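{- Let $k\ge 2$ be an even integer. Among all simple $k$-regular graphs with $2k+1$ vertices and $k^2+k/2$ edges, the maximum girth is $5$ if $k=2$ and $3$ if $k\geq 4$. Moreover, there exist simple graphs (not required to be regular) with $2k+1$ vertices and $k^2+k/2$ edges having girth $4$.
   Context: Graphs are finite, simple and undirected. A graph is $k$-regular if every vertex has degree $k$. The girth of a graph is the length of a shortest cycle in it. An $(n,e)$-graph is a simple graph with $n$ vertices and $e$ edges. -}

module Defs where

open import Data.Nat using (ℕ; zero; suc; _+_; _*_; _≤_; _<ᵇ_)
open import Data.Nat.Divisibility using (_∣_)
open import Data.Nat.DivMod using (_/_)
open import Data.Bool using (Bool; true; false; _∧_; if_then_else_)
open import Data.Fin using (Fin; toℕ; inject₁; fromℕ) renaming (zero to fzero; suc to fsuc)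
open import Data.List using (List; allFin; map)
open import Data.Nat.ListAction using (sum)
open import Data.Product using (Σ; _×_; ∃)
open import Relation.Binary.PropositionalEquality using (_≡_)
open import Relation.Nullary using (¬_)

record Graph (n : ℕ) : Set where
  field
    adj    : Fin n → Fin n → Bool
    sym    : ∀ i j → adj i j ≡ adj j i
    irrefl : ∀ i → adj i i ≡ false
open Graph public

b2n : Bool → ℕ
b2n true  = 1
b2n false = 0

degree : ∀ {n} → Graph n → Fin n → ℕ
degree {n} G i = sum (map (λ j → b2n (adj G i j)) (allFin n))

edgeCount : ∀ {n} → Graph n → ℕ
edgeCount {n} G =
  sum (map (λ i → sum (map (λ j → b2n ((toℕ i <ᵇ toℕ j) ∧ adj G i j)) (allFin n))) (allFin n))

Regular : ∀ {n} → ℕ → Graph n → Set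
Regular k G = ∀ i → degree G i ≡ k

-- G contains a cycle of length m (m ≥ 3): closed walk w 0 ~ w 1 ~ ... ~ w m = w 0
-- whose first m vertices w 0, ..., w (m-1) are pairwise distinct.
HasCycle : ∀ {n} → Graph n → ℕ → Set
HasCycle {n} G m =
  3 ≤ m × Σ (Fin (suc m) → Fin n) λ w →
      (w fzero ≡ w (fromℕ m))
    × (∀ (i : Fin m) → adj G (w (inject₁ i)) (w (fsuc i)) ≡ true)
    × (∀ (i j : Fin m) → w (inject₁ i) ≡ w (inject₁ j) → i ≡ j)

Girth : ∀ {n} → Graph n → ℕ → Set
Girth G g = HasCycle G g × (∀ m → HasCycle G m → g ≤ m)

IsRegClass : (k : ℕ) → Graph (suc (2 * k)) → Set
IsRegClass k G = Regular k G × edgeCount G ≡ k * k + k / 2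

MaxGirth : ℕ → ℕ → Set
MaxGirth k g =
    (Σ (Graph (suc (2 * k))) λ G → IsRegClass k G × Girth G g)
  × (∀ (G : Graph (suc (2 * k))) (g' : ℕ) → IsRegClass k G → Girth G g' → g' ≤ g)

{-# OPTIONS --safe #-}

-- A triangle-free k-regular graph on 2k+1 vertices with k ≥ 3 cannot exist: for an edge uv the
-- neighbourhoods N(u), N(v) are disjoint of size k, so they miss exactly one vertex w; counting
-- neighbourhoods around w shows that w has exactly one neighbour in each of N(u) and N(v),
-- whence k = deg w ≤ 2. For k = 2h, K_{k,k} minus an h-edge matching, plus a vertex joined to the
-- 2h matched vertices, is k-regular; K_{k,k} plus a vertex joined to h vertices of one side is
-- bipartite and contains a 4-cycle. Both have k² + h edges by the handshake lemma. For k = 2 the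
-- pentagon has girth 5, the largest possible on five vertices.

module Submission where

open import Defs
open import Data.Bool using (Bool; true; false; _∧_; _∨_; not)
open import Data.Bool.Properties using (∧-zeroʳ; not-¬; not-involutive) renaming (_≟_ to _≟ᵇ_)
open import Data.Fin using (Fin; toℕ; inject₁; _↑ˡ_; _↑ʳ_; splitAt) renaming (zero to fzero; suc to fsuc)
open import Data.Fin.Patterns using (0F; 1F; 2F; 3F; 4F; 5F)
open import Data.Fin.Properties using (_≟_; any?; all?; pigeonhole; toℕ-injective; splitAt-↑ˡ; splitAt-↑ʳ)
open import Data.List using (allFin; map; tabulate)
open import Data.List.Properties using (map-tabulate)
open import Data.Nat using (ℕ; zero; suc; _+_; _*_; _≤_; _<_; z≤n; s≤s; _<ᵇ_; _≡ᵇ_; _<?_; ⌊_/2⌋)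
open import Data.Nat.Divisibility using (_∣_; divides)
open import Data.Nat.DivMod using (_/_; m*n/n≡m)
open import Data.Nat.ListAction using (sum)
open import Data.Nat.Properties
  using ( +-assoc; +-comm; +-identityʳ; *-comm; *-identityʳ; +-cancelˡ-≡; +-cancelʳ-≤
        ; +-mono-≤; +-monoʳ-≤; ≤-refl; ≤-reflexive; ≤-trans; ≤-antisym; <-irrefl; ≤∧≢⇒<
        ; <⇒≱; ≮⇒≥; n<1+n; n≤1+n; m≤m+n; m≤n+m; n≡⌊n+n/2⌋; +-0-commutativeMonoid; module ≤-Reasoning )
  renaming (_≟_ to _≟ℕ_)
open import Algebra.Properties.CommutativeMonoid.Sum +-0-commutativeMonoid
  using (sum-cong-≗; sum-replicate-zero; ∑-distrib-+; ∑-comm) renaming (sum to ∑)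
open import Data.Nat.Tactic.RingSolver using (solve-∀)
open import Data.Product using (Σ; Σ-syntax; ∃; _×_; _,_; proj₁; proj₂; swap)
open import Data.Sum using (_⊎_; inj₁; inj₂; [_,_]′)
open import Function using (_∘_; id; case_of_)
open import Relation.Nullary using (¬_; Dec; yes; no; does; contradiction)
open import Relation.Nullary.Decidable using (_×-dec_; _→-dec_; ¬?; from-yes; from-no; decidable-stable)
open import Relation.Binary.PropositionalEquality
  using (_≡_; _≢_; refl; trans; cong; cong₂; subst; subst₂; module ≡-Reasoning) renaming (sym to ≡-sym)

sum-tabulate : ∀ {n} (f : Fin n → ℕ) → sum (tabulate f) ≡ ∑ f
sum-tabulate {zero}  f = refl
sum-tabulate {suc n} f = cong (f fzero +_) (sum-tabulate (f ∘ fsuc))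

sum-allFin : ∀ {n} (f : Fin n → ℕ) → sum (map f (allFin n)) ≡ ∑ f
sum-allFin {n} f = trans (cong sum (map-tabulate id f)) (sum-tabulate f)

∑-const : ∀ n c → ∑ {n} (λ _ → c) ≡ n * c
∑-const zero    c = refl
∑-const (suc n) c = cong (c +_) (∑-const n c)

∑-one : ∀ n → ∑ {n} (λ _ → 1) ≡ n
∑-one n = trans (∑-const n 1) (*-identityʳ n)

∑-mono-≤ : ∀ {n} {f g : Fin n → ℕ} → (∀ j → f j ≤ g j) → ∑ f ≤ ∑ g
∑-mono-≤ {zero}  f≤g = z≤n
∑-mono-≤ {suc n} f≤g = +-mono-≤ (f≤g fzero) (∑-mono-≤ (f≤g ∘ fsuc))

∑-<⇒∃-< : ∀ {n} {f g : Fin n → ℕ} → ∑ f < ∑ g → ∃ λ j → f j < g j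
∑-<⇒∃-< {f = f} {g} ∑f<∑g = decidable-stable (any? λ j → f j <? g j)
  λ ¬∃ → <⇒≱ ∑f<∑g (∑-mono-≤ λ j → ≮⇒≥ λ fj<gj → ¬∃ (j , fj<gj))

∑-pos⇒∃-pos : ∀ {n} {f : Fin n → ℕ} → 0 < ∑ f → ∃ λ j → 0 < f j
∑-pos⇒∃-pos {n} {f} 0<∑f = ∑-<⇒∃-< (subst (_< ∑ f) (≡-sym (sum-replicate-zero n)) 0<∑f)

∑-mono-≤-tight : ∀ {n} {f g : Fin n → ℕ} → (∀ j → f j ≤ g j) → ∑ f ≡ ∑ g → ∀ j → f j ≡ g j
∑-mono-≤-tight {suc n} {f} {g} f≤g ∑f≡∑g = λ where
    fzero    → head≡
    (fsuc j) → ∑-mono-≤-tight (f≤g ∘ fsuc) (+-cancelˡ-≡ (f fzero) _ _ (trans ∑f≡∑g (cong (_+ _) (≡-sym head≡)))) j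
  where
  open ≤-Reasoning
  head≡ : f fzero ≡ g fzero
  head≡ = ≤-antisym (f≤g fzero) (+-cancelʳ-≤ (∑ (g ∘ fsuc)) (g fzero) (f fzero) (begin
    g fzero + ∑ (g ∘ fsuc) ≡⟨ ≡-sym ∑f≡∑g ⟩
    f fzero + ∑ (f ∘ fsuc) ≤⟨ +-monoʳ-≤ (f fzero) (∑-mono-≤ (f≤g ∘ fsuc)) ⟩
    f fzero + ∑ (g ∘ fsuc) ∎))

δ : ∀ {n} → Fin n → Fin n → ℕ
δ t j = b2n (does (t ≟ j))

∑-δ : ∀ {n} (t : Fin n) → ∑ (δ t) ≡ 1
∑-δ {suc n} fzero    = cong suc (sum-replicate-zero n)
∑-δ {suc n} (fsuc t) = ∑-δ t

2*k≡k+k : ∀ k → 2 * k ≡ k + k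
2*k≡k+k k = cong (k +_) (+-identityʳ k)

b2n≤1 : ∀ b → b2n b ≤ 1
b2n≤1 false = z≤n
b2n≤1 true  = ≤-refl

b2n-pos : ∀ {b} → 0 < b2n b → b ≡ true
b2n-pos {true} _ = refl

b2n-not+b2n : ∀ b → b2n (not b) + b2n b ≡ 1
b2n-not+b2n true  = refl
b2n-not+b2n false = refl

∑-↑ : ∀ a {b} (f : Fin (a + b) → ℕ) → ∑ f ≡ ∑ (f ∘ (_↑ˡ b)) + ∑ (f ∘ (a ↑ʳ_))
∑-↑ zero    f = refl
∑-↑ (suc a) f = trans (cong (f fzero +_) (∑-↑ a (f ∘ fsuc))) (≡-sym (+-assoc (f fzero) _ _))

∑-<ᵇ : ∀ {n} h → h ≤ n → ∑ {n} (λ i → b2n (toℕ i <ᵇ h)) ≡ h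
∑-<ᵇ {n}     zero    _         = sum-replicate-zero n
∑-<ᵇ {suc n} (suc h) (s≤s h≤n) = cong suc (∑-<ᵇ h h≤n)

∑-not+∑ : ∀ {n} (p : Fin n → Bool) → ∑ (λ j → b2n (not (p j))) + ∑ (λ j → b2n (p j)) ≡ n
∑-not+∑ {n} p = trans (≡-sym (∑-distrib-+ (λ j → b2n (not (p j))) (λ j → b2n (p j))))
                      (trans (sum-cong-≗ (b2n-not+b2n ∘ p)) (∑-one n))

-- Degrees and the handshake lemma

nbr : ∀ {n} → Graph n → Fin n → Fin n → ℕ
nbr G x j = b2n (adj G x j)

degree≡∑nbr : ∀ {n} (G : Graph n) x → degree G x ≡ ∑ (nbr G x)
degree≡∑nbr G x = sum-allFin (nbr G x)

ascendingEdge : ∀ {n} → Graph n → Fin n → Fin n → ℕ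
ascendingEdge G i j = b2n ((toℕ i <ᵇ toℕ j) ∧ adj G i j)

edgeCount≡∑∑ascendingEdge : ∀ {n} (G : Graph n) → edgeCount G ≡ ∑ λ i → ∑ (ascendingEdge G i)
edgeCount≡∑∑ascendingEdge {n} G =
  trans (sum-allFin (λ i → sum (map (ascendingEdge G i) (allFin n)))) (sum-cong-≗ (sum-allFin ∘ ascendingEdge G))

<ᵇ-flip : ∀ m n → m ≢ n → (n <ᵇ m) ≡ not (m <ᵇ n)
<ᵇ-flip zero    zero    m≢n = contradiction refl m≢n
<ᵇ-flip zero    (suc n) _   = refl
<ᵇ-flip (suc m) zero    _   = refl
<ᵇ-flip (suc m) (suc n) m≢n = <ᵇ-flip m n (m≢n ∘ cong suc)

b2n-split : ∀ c b → b2n b ≡ b2n (c ∧ b) + b2n (not c ∧ b)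
b2n-split true  b = ≡-sym (+-identityʳ (b2n b))
b2n-split false b = refl

nbr≡ascendingEdge+ascendingEdge : ∀ {n} (G : Graph n) i j → nbr G i j ≡ ascendingEdge G i j + ascendingEdge G j i
nbr≡ascendingEdge+ascendingEdge G i j with i ≟ j
... | yes refl rewrite irrefl G i | ∧-zeroʳ (toℕ i <ᵇ toℕ i) = refl
... | no i≢j = begin
  b2n (adj G i j)                                           ≡⟨ b2n-split (toℕ i <ᵇ toℕ j) (adj G i j) ⟩
  ascendingEdge G i j + b2n (not (toℕ i <ᵇ toℕ j) ∧ adj G i j) ≡⟨ cong₂ (λ c b → ascendingEdge G i j + b2n (c ∧ b))
                                                                  (≡-sym (<ᵇ-flip (toℕ i) (toℕ j) (i≢j ∘ toℕ-injective))) (sym G i j) ⟩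
  ascendingEdge G i j + ascendingEdge G j i                  ∎
  where open ≡-Reasoning

handshake : ∀ {n} (G : Graph n) → ∑ (degree G) ≡ edgeCount G + edgeCount G
handshake G = begin
  ∑ (degree G)                             ≡⟨ sum-cong-≗ (degree≡∑nbr G) ⟩
  ∑ (λ i → ∑ (nbr G i))                    ≡⟨ sum-cong-≗ (λ i → sum-cong-≗ (nbr≡ascendingEdge+ascendingEdge G i)) ⟩
  ∑ (λ i → ∑ λ j → e i j + e j i)          ≡⟨ sum-cong-≗ (λ i → ∑-distrib-+ (e i) (λ j → e j i)) ⟩
  ∑ (λ i → ∑ (e i) + ∑ λ j → e j i)        ≡⟨ ∑-distrib-+ (λ i → ∑ (e i)) (λ i → ∑ λ j → e j i) ⟩
  ∑ (λ i → ∑ (e i)) + ∑ (λ i → ∑ λ j → e j i) ≡⟨ cong (∑ (λ i → ∑ (e i)) +_) (∑-comm λ i j → e j i) ⟩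
  ∑ (λ i → ∑ (e i)) + ∑ (λ i → ∑ (e i))    ≡⟨ cong₂ _+_ (edgeCount≡∑∑ascendingEdge G) (edgeCount≡∑∑ascendingEdge G) ⟨
  edgeCount G + edgeCount G                ∎
  where
  open ≡-Reasoning
  e = ascendingEdge G

m+m≡n+n⇒m≡n : ∀ {m n} → m + m ≡ n + n → m ≡ n
m+m≡n+n⇒m≡n {m} {n} eq = trans (n≡⌊n+n/2⌋ m) (trans (cong ⌊_/2⌋ eq) (≡-sym (n≡⌊n+n/2⌋ n)))

regular⇒edgeCount : ∀ {n k} (G : Graph n) → Regular k G → edgeCount G + edgeCount G ≡ n * k
regular⇒edgeCount {n} {k} G regular = trans (≡-sym (handshake G)) (trans (sum-cong-≗ regular) (∑-const n k))

Triangle : ∀ {n} → Graph n → Set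
Triangle {n} G = Σ[ a ∈ Fin n ] Σ[ b ∈ Fin n ] Σ[ c ∈ Fin n ]
  adj G a b ≡ true × adj G b c ≡ true × adj G c a ≡ true

Square : ∀ {n} → Graph n → Set
Square {n} G = Σ[ a ∈ Fin n ] Σ[ b ∈ Fin n ] Σ[ c ∈ Fin n ] Σ[ d ∈ Fin n ]
  adj G a b ≡ true × adj G b c ≡ true × adj G c d ≡ true × adj G d a ≡ true × a ≢ c × b ≢ d

triangle? : ∀ {n} (G : Graph n) → Dec (Triangle G)
triangle? G = any? λ a → any? λ b → any? λ c →
  (adj G a b ≟ᵇ true) ×-dec (adj G b c ≟ᵇ true) ×-dec (adj G c a ≟ᵇ true)

square? : ∀ {n} (G : Graph n) → Dec (Square G)
square? G = any? λ a → any? λ b → any? λ c → any? λ d →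
  (adj G a b ≟ᵇ true) ×-dec (adj G b c ≟ᵇ true) ×-dec (adj G c d ≟ᵇ true) ×-dec (adj G d a ≟ᵇ true)
  ×-dec ¬? (a ≟ c) ×-dec ¬? (b ≟ d)

adjacent⇒≢ : ∀ {n} (G : Graph n) {x y} → adj G x y ≡ true → x ≢ y
adjacent⇒≢ G {x} x~x refl = case trans (≡-sym x~x) (irrefl G x) of λ ()

triangle⇒cycle₃ : ∀ {n} (G : Graph n) → Triangle G → HasCycle G 3
triangle⇒cycle₃ {n} G (a , b , c , a~b , b~c , c~a) = s≤s (s≤s (s≤s z≤n)) , walk , refl , step , injective
  where
  walk : Fin 4 → Fin n
  walk 0F = a
  walk 1F = b
  walk 2F = c
  walk 3F = a
  step : ∀ i → adj G (walk (inject₁ i)) (walk (fsuc i)) ≡ true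
  step 0F = a~b
  step 1F = b~c
  step 2F = c~a
  injective : ∀ i j → walk (inject₁ i) ≡ walk (inject₁ j) → i ≡ j
  injective 0F 0F _ = refl
  injective 1F 1F _ = refl
  injective 2F 2F _ = refl
  injective 0F 1F e = contradiction e (adjacent⇒≢ G a~b)
  injective 1F 0F e = contradiction (≡-sym e) (adjacent⇒≢ G a~b)
  injective 1F 2F e = contradiction e (adjacent⇒≢ G b~c)
  injective 2F 1F e = contradiction (≡-sym e) (adjacent⇒≢ G b~c)
  injective 2F 0F e = contradiction e (adjacent⇒≢ G c~a)
  injective 0F 2F e = contradiction (≡-sym e) (adjacent⇒≢ G c~a)

cycle₃⇒triangle : ∀ {n} (G : Graph n) → HasCycle G 3 → Triangle G
cycle₃⇒triangle G (_ , w , closed , step , _) =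
  w 0F , w 1F , w 2F , step 0F , step 1F , subst (λ z → adj G (w 2F) z ≡ true) (≡-sym closed) (step 2F)

square⇒cycle₄ : ∀ {n} (G : Graph n) → Square G → HasCycle G 4
square⇒cycle₄ {n} G (a , b , c , d , a~b , b~c , c~d , d~a , a≢c , b≢d) =
  s≤s (s≤s (s≤s z≤n)) , walk , refl , step , injective
  where
  walk : Fin 5 → Fin n
  walk 0F = a
  walk 1F = b
  walk 2F = c
  walk 3F = d
  walk 4F = a
  step : ∀ i → adj G (walk (inject₁ i)) (walk (fsuc i)) ≡ true
  step 0F = a~b
  step 1F = b~c
  step 2F = c~d
  step 3F = d~a
  injective : ∀ i j → walk (inject₁ i) ≡ walk (inject₁ j) → i ≡ j
  injective 0F 0F _ = refl
  injective 1F 1F _ = refl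
  injective 2F 2F _ = refl
  injective 3F 3F _ = refl
  injective 0F 1F e = contradiction e (adjacent⇒≢ G a~b)
  injective 1F 0F e = contradiction (≡-sym e) (adjacent⇒≢ G a~b)
  injective 1F 2F e = contradiction e (adjacent⇒≢ G b~c)
  injective 2F 1F e = contradiction (≡-sym e) (adjacent⇒≢ G b~c)
  injective 2F 3F e = contradiction e (adjacent⇒≢ G c~d)
  injective 3F 2F e = contradiction (≡-sym e) (adjacent⇒≢ G c~d)
  injective 3F 0F e = contradiction e (adjacent⇒≢ G d~a)
  injective 0F 3F e = contradiction (≡-sym e) (adjacent⇒≢ G d~a)
  injective 0F 2F e = contradiction e a≢c
  injective 2F 0F e = contradiction (≡-sym e) a≢c
  injective 1F 3F e = contradiction e b≢d
  injective 3F 1F e = contradiction (≡-sym e) b≢d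

cycle₄⇒square : ∀ {n} (G : Graph n) → HasCycle G 4 → Square G
cycle₄⇒square G (_ , w , closed , step , injective) =
  w 0F , w 1F , w 2F , w 3F , step 0F , step 1F , step 2F ,
  subst (λ z → adj G (w 3F) z ≡ true) (≡-sym closed) (step 3F) ,
  (λ e → case injective 0F 2F e of λ ()) , (λ e → case injective 1F 3F e of λ ())

cycle-length≤order : ∀ {n} (G : Graph n) {m} → HasCycle G m → m ≤ n
cycle-length≤order {n} G {m} (_ , w , _ , _ , injective) = ≮⇒≥ λ n<m →
  let i , j , i<j , wi≡wj = pigeonhole n<m (w ∘ inject₁) in <-irrefl (cong toℕ (injective i j wi≡wj)) i<j

triangle-free⇒cycle-length≥4 : ∀ {n} {G : Graph n} {m} → ¬ Triangle G → HasCycle G m → 4 ≤ m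
triangle-free⇒cycle-length≥4 {m = 0} _ (() , _)
triangle-free⇒cycle-length≥4 {m = 1} _ (s≤s () , _)
triangle-free⇒cycle-length≥4 {m = 2} _ (s≤s (s≤s ()) , _)
triangle-free⇒cycle-length≥4 {G = G} {m = 3} ¬△ c = contradiction (cycle₃⇒triangle G c) ¬△
triangle-free⇒cycle-length≥4 {m = suc (suc (suc (suc _)))} _ _ = s≤s (s≤s (s≤s (s≤s z≤n)))

square-free⇒cycle-length≥5 : ∀ {n} {G : Graph n} {m} → ¬ Triangle G → ¬ Square G → HasCycle G m → 5 ≤ m
square-free⇒cycle-length≥5 {G = G} ¬△ ¬□ c = ≤∧≢⇒< (triangle-free⇒cycle-length≥4 {G = G} ¬△ c) λ { refl → ¬□ (cycle₄⇒square G c) }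

triangle⇒girth₃ : ∀ {n} {G : Graph n} → Triangle G → Girth G 3
triangle⇒girth₃ {G = G} △ = triangle⇒cycle₃ G △ , λ _ → proj₁

bipartite⇒triangle-free : ∀ {n} (G : Graph n) (colour : Fin n → Bool) →
  (∀ x y → adj G x y ≡ true → colour y ≡ not (colour x)) → ¬ Triangle G
bipartite⇒triangle-free G colour proper (a , b , c , a~b , b~c , c~a) = not-¬ refl (begin
  colour a             ≡⟨ proper c a c~a ⟩
  not (colour c)       ≡⟨ cong not (proper b c b~c) ⟩
  not (not (colour b)) ≡⟨ not-involutive (colour b) ⟩
  colour b             ≡⟨ proper a b a~b ⟩
  not (colour a)       ∎)
  where open ≡-Reasoning

-- Triangles in k-regular graphs on 2k+1 vertices

module TriangleFreeRegular {k : ℕ} (G : Graph (suc (2 * k))) (regular : Regular k G) (triangle-free : ¬ Triangle G) where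

  V = Fin (suc (2 * k))

  _~_ _≁_ : V → V → Set
  x ~ y = adj G x y ≡ true
  x ≁ y = adj G x y ≡ false

  ~-sym : ∀ {x y} → x ~ y → y ~ x
  ~-sym {x} {y} x~y = trans (sym G y x) x~y

  ≁-sym : ∀ {x y} → x ≁ y → y ≁ x
  ≁-sym {x} {y} x≁y = trans (sym G y x) x≁y

  no-common-neighbour : ∀ {x y j} → x ~ y → x ~ j → y ≁ j
  no-common-neighbour {x} {y} {j} x~y x~j with adj G y j in y~j
  ... | false = refl
  ... | true  = contradiction (x , j , y , x~j , ~-sym y~j , ~-sym x~y) triangle-free

  nbr-disjoint : ∀ {x y} → x ~ y → ∀ j → nbr G x j + nbr G y j ≤ 1
  nbr-disjoint {x} {y} x~y j with adj G x j in x~j | adj G y j in y~j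
  ... | false | b     = b2n≤1 b
  ... | true  | false = ≤-refl
  ... | true  | true  = case trans (≡-sym y~j) (no-common-neighbour x~y x~j) of λ ()

  ∑nbr≡k : ∀ x → ∑ (nbr G x) ≡ k
  ∑nbr≡k x = trans (≡-sym (degree≡∑nbr G x)) (regular x)

  ∑nbr+∑nbr≡k+k : ∀ x y → ∑ (λ j → nbr G x j + nbr G y j) ≡ k + k
  ∑nbr+∑nbr≡k+k x y = trans (∑-distrib-+ (nbr G x) (nbr G y)) (cong₂ _+_ (∑nbr≡k x) (∑nbr≡k y))

  ∑1≡1+k+k : ∑ {suc (2 * k)} (λ _ → 1) ≡ suc (k + k)
  ∑1≡1+k+k = trans (∑-one (suc (2 * k))) (cong suc (2*k≡k+k k))

  ∃-neighbour : 0 < k → ∀ x → ∃ λ y → x ~ y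
  ∃-neighbour 0<k x =
    let y , 0<xy = ∑-pos⇒∃-pos {f = nbr G x} (subst (0 <_) (≡-sym (∑nbr≡k x)) 0<k) in y , b2n-pos 0<xy

  ∃-common-non-neighbour : ∀ {x y} → x ~ y → ∃ λ t → x ≁ t × y ≁ t
  ∃-common-non-neighbour {x} {y} x~y with ∑-<⇒∃-< {f = λ j → nbr G x j + nbr G y j} {g = λ _ → 1} ∑<
    where
    ∑< : ∑ (λ j → nbr G x j + nbr G y j) < ∑ {suc (2 * k)} (λ _ → 1)
    ∑< = subst₂ _<_ (≡-sym (∑nbr+∑nbr≡k+k x y)) (≡-sym ∑1≡1+k+k) (n<1+n (k + k))
  ... | t , nbrs<1 with adj G x t in x~t | adj G y t in y~t | nbrs<1
  ... | false | false | _       = t , x~t , y~t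
  ... | true  | _     | s≤s ()
  ... | false | true  | s≤s ()

  -- Since |N(x)| + |N(y)| = 2k and the neighbourhoods of adjacent x, y are disjoint,
  -- N(x), N(y) and {t} partition the 2k+1 vertices.
  nbr-partition : ∀ {x y t j} → x ~ y → x ≁ t → y ≁ t → t ≢ j → x ~ j ⊎ y ~ j
  nbr-partition {x} {y} {t} {j} x~y x≁t y≁t t≢j = cover (∑-mono-≤-tight bounded total j)
    where
    bounded : ∀ j → nbr G x j + nbr G y j + δ t j ≤ 1
    bounded j with t ≟ j
    ... | yes refl rewrite x≁t | y≁t = ≤-refl
    ... | no _ = ≤-trans (≤-reflexive (+-identityʳ _)) (nbr-disjoint x~y j)
    total : ∑ (λ j → nbr G x j + nbr G y j + δ t j) ≡ ∑ {suc (2 * k)} (λ _ → 1)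
    total = begin
      ∑ (λ j → nbr G x j + nbr G y j + δ t j)   ≡⟨ ∑-distrib-+ (λ j → nbr G x j + nbr G y j) (δ t) ⟩
      ∑ (λ j → nbr G x j + nbr G y j) + ∑ (δ t) ≡⟨ cong₂ _+_ (∑nbr+∑nbr≡k+k x y) (∑-δ t) ⟩
      k + k + 1                                 ≡⟨ +-comm (k + k) 1 ⟩
      suc (k + k)                               ≡⟨ ∑1≡1+k+k ⟨
      ∑ {suc (2 * k)} (λ _ → 1)                 ∎
      where open ≡-Reasoning
    cover : nbr G x j + nbr G y j + δ t j ≡ 1 → x ~ j ⊎ y ~ j
    cover eq with t ≟ j | adj G x j | adj G y j
    ... | yes t≡j | _     | _     = contradiction t≡j t≢j
    ... | no _    | true  | _     = inj₁ refl
    ... | no _    | false | true  = inj₂ refl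
    ... | no _    | false | false = case eq of λ ()

  commonAt : V → V → V → ℕ
  commonAt x y j = b2n (adj G x j ∧ adj G y j)

  common : V → V → ℕ
  common x y = ∑ (commonAt x y)

  common-witness : ∀ {x y} → common x y ≡ 1 → ∃ λ j → x ~ j × y ~ j
  common-witness {x} {y} common≡1 with ∑-pos⇒∃-pos {f = commonAt x y} (≤-reflexive (≡-sym common≡1))
  ... | j , 0<xy with adj G x j in x~j | adj G y j in y~j | 0<xy
  ... | true | true | _ = j , x~j , y~j

  -- y is a neighbour of w inside N(v); counting N(y) = (N(u) ∩ N(y)) ⊎ {w}
  -- and N(u) = (N(u) ∩ N(y)) ⊎ (N(u) ∩ N(w)) leaves exactly one vertex for N(u) ∩ N(w).
  common≡1 : ∀ {u v w y} → u ~ v → u ≁ w → v ≁ w → y ~ w → y ~ v → common u w ≡ 1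
  common≡1 {u} {v} {w} {y} u~v u≁w v≁w y~w y~v = +-cancelˡ-≡ (common u y) _ _ (begin
    common u y + common u w ≡⟨ ∑nbr-u ⟨
    ∑ (nbr G u)             ≡⟨ ∑nbr≡k u ⟩
    k                       ≡⟨ ∑nbr≡k y ⟨
    ∑ (nbr G y)             ≡⟨ ∑nbr-y ⟩
    common u y + 1          ∎)
    where
    open ≡-Reasoning
    y≁u : y ≁ u
    y≁u = no-common-neighbour (~-sym y~v) (~-sym u~v)
    nbr-y : ∀ j → nbr G y j ≡ commonAt u y j + δ w j
    nbr-y j with w ≟ j
    ... | yes refl rewrite y~w | u≁w = refl
    ... | no w≢j with adj G y j in y~j
    ...   | false = cong (_+ 0) (cong b2n (≡-sym (∧-zeroʳ (adj G u j))))
    ...   | true with nbr-partition u~v u≁w v≁w w≢j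
    ...     | inj₁ u~j rewrite u~j = refl
    ...     | inj₂ v~j = case trans (≡-sym y~j) (no-common-neighbour (~-sym y~v) v~j) of λ ()
    nbr-u : ∀ j → nbr G u j ≡ commonAt u y j + commonAt u w j
    nbr-u j with adj G u j in u~j
    ... | false = refl
    ... | true with nbr-partition y~w y≁u (≁-sym u≁w) (adjacent⇒≢ G u~j)
    ...   | inj₁ y~j rewrite y~j | no-common-neighbour y~w y~j = refl
    ...   | inj₂ w~j rewrite w~j | no-common-neighbour (~-sym y~w) w~j = refl
    ∑nbr-y : ∑ (nbr G y) ≡ common u y + 1
    ∑nbr-y = trans (sum-cong-≗ nbr-y) (trans (∑-distrib-+ (commonAt u y) (δ w)) (cong (common u y +_) (∑-δ w)))
    ∑nbr-u : ∑ (nbr G u) ≡ common u y + common u w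
    ∑nbr-u = trans (sum-cong-≗ nbr-u) (∑-distrib-+ (commonAt u y) (commonAt u w))

  common-pair : ∀ {u v w t} → u ~ v → u ≁ w → v ≁ w → w ~ t → v ~ t → common u w ≡ 1 × common v w ≡ 1
  common-pair u~v u≁w v≁w w~t v~t =
    let common-uw≡1 = common≡1 u~v u≁w v≁w (~-sym w~t) (~-sym v~t)
        x , u~x , w~x = common-witness common-uw≡1
    in common-uw≡1 , common≡1 (~-sym u~v) v≁w u≁w (~-sym w~x) (~-sym u~x)

  ∑nbr≤common+common : ∀ {u v w} → u ~ v → u ≁ w → v ≁ w → ∑ (nbr G w) ≤ common u w + common v w
  ∑nbr≤common+common {u} {v} {w} u~v u≁w v≁w = begin
    ∑ (nbr G w)                                                        ≤⟨ ∑-mono-≤ bounded ⟩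
    ∑ (λ j → commonAt u w j + commonAt v w j) ≡⟨ ∑-distrib-+ (commonAt u w) (commonAt v w) ⟩
    common u w + common v w                                            ∎
    where
    open ≤-Reasoning
    bounded : ∀ j → nbr G w j ≤ commonAt u w j + commonAt v w j
    bounded j with adj G w j in w~j
    ... | false = z≤n
    ... | true with nbr-partition u~v u≁w v≁w (adjacent⇒≢ G w~j)
    ...   | inj₁ u~j rewrite u~j = s≤s z≤n
    ...   | inj₂ v~j rewrite v~j = m≤n+m 1 _

  -- The neighbour t of w lies in N(u) or N(v); swapping u and v if needed,
  -- common-pair shows that w has exactly one neighbour in each.
  ∑nbr≤2 : ∀ {u v w t} → u ~ v → u ≁ w → v ≁ w → w ~ t → ∑ (nbr G w) ≤ 2
  ∑nbr≤2 {u} {v} {w} {t} u~v u≁w v≁w w~t = begin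
    ∑ (nbr G w)             ≤⟨ ∑nbr≤common+common u~v u≁w v≁w ⟩
    common u w + common v w ≡⟨ cong₂ _+_ (proj₁ common≡1×common≡1) (proj₂ common≡1×common≡1) ⟩
    2                       ∎
    where
    open ≤-Reasoning
    common≡1×common≡1 : common u w ≡ 1 × common v w ≡ 1
    common≡1×common≡1 with nbr-partition u~v u≁w v≁w (adjacent⇒≢ G w~t)
    ... | inj₁ u~t = swap (common-pair (~-sym u~v) v≁w u≁w w~t u~t)
    ... | inj₂ v~t = common-pair u~v u≁w v≁w w~t v~t

  ¬3≤k : ¬ 3 ≤ k
  ¬3≤k 3≤k =
    let 0<k = ≤-trans (s≤s z≤n) 3≤k
        v , u~v = ∃-neighbour 0<k 0F
        w , u≁w , v≁w = ∃-common-non-neighbour u~v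
        t , w~t = ∃-neighbour 0<k w
    in <⇒≱ 3≤k (subst (_≤ 2) (∑nbr≡k w) (∑nbr≤2 u~v u≁w v≁w w~t))

regular⇒triangle : ∀ {k} (G : Graph (suc (2 * k))) → 3 ≤ k → Regular k G → Triangle G
regular⇒triangle G 3≤k regular =
  decidable-stable (triangle? G) λ triangle-free → TriangleFreeRegular.¬3≤k G regular triangle-free 3≤k

regular⇒girth₃ : ∀ {k} (G : Graph (suc (2 * k))) → 3 ≤ k → Regular k G → Girth G 3
regular⇒girth₃ G 3≤k regular = triangle⇒girth₃ {G = G} (regular⇒triangle G 3≤k regular)

-- Graphs built from a hub and two blocks of vertices

data Vertex (a b : ℕ) : Set where
  hub   : Vertex a b
  left  : Fin a → Vertex a b
  right : Fin b → Vertex a b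

module BlockGraph {a b : ℕ} (edge : Vertex a b → Vertex a b → Bool)
                  (edge-sym : ∀ x y → edge x y ≡ edge y x) (edge-irrefl : ∀ x → edge x x ≡ false) where

  view : Fin (suc (a + b)) → Vertex a b
  view 0F       = hub
  view (fsuc p) = [ left , right ]′ (splitAt a p)

  graph : Graph (suc (a + b))
  graph = record
    { adj    = λ p q → edge (view p) (view q)
    ; sym    = λ p q → edge-sym (view p) (view q)
    ; irrefl = edge-irrefl ∘ view
    }

  embedˡ : Fin a → Fin (suc (a + b))
  embedˡ i = fsuc (i ↑ˡ b)

  embedʳ : Fin b → Fin (suc (a + b))
  embedʳ j = fsuc (a ↑ʳ j)

  view-embedˡ : ∀ i → view (embedˡ i) ≡ left i
  view-embedˡ i = cong [ left , right ]′ (splitAt-↑ˡ a i b)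

  view-embedʳ : ∀ j → view (embedʳ j) ≡ right j
  view-embedʳ j = cong [ left , right ]′ (splitAt-↑ʳ a b j)

  ∑ⱽ : (Vertex a b → ℕ) → ℕ
  ∑ⱽ F = F hub + (∑ (F ∘ left) + ∑ (F ∘ right))

  ∑-view : ∀ F → ∑ (F ∘ view) ≡ ∑ⱽ F
  ∑-view F = cong (F hub +_) (trans (∑-↑ a (F ∘ view ∘ fsuc))
    (cong₂ _+_ (sum-cong-≗ (cong F ∘ view-embedˡ)) (sum-cong-≗ (cong F ∘ view-embedʳ))))

  degreeⱽ : Vertex a b → ℕ
  degreeⱽ x = ∑ⱽ λ y → b2n (edge x y)

  degree-view : ∀ p → degree graph p ≡ degreeⱽ (view p)
  degree-view p = trans (degree≡∑nbr graph p) (∑-view λ y → b2n (edge (view p) y))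

  ∑degree≡∑ⱽdegreeⱽ : ∑ (degree graph) ≡ ∑ⱽ degreeⱽ
  ∑degree≡∑ⱽdegreeⱽ = trans (sum-cong-≗ degree-view) (∑-view degreeⱽ)

  embedˡ-injective : ∀ {i i′} → embedˡ i ≡ embedˡ i′ → i ≡ i′
  embedˡ-injective {i} {i′} e with trans (≡-sym (view-embedˡ i)) (trans (cong view e) (view-embedˡ i′))
  ... | refl = refl

  embedʳ-injective : ∀ {j j′} → embedʳ j ≡ embedʳ j′ → j ≡ j′
  embedʳ-injective {j} {j′} e with trans (≡-sym (view-embedʳ j)) (trans (cong view e) (view-embedʳ j′))
  ... | refl = refl

  adj-embedˡʳ : ∀ i j → adj graph (embedˡ i) (embedʳ j) ≡ edge (left i) (right j)
  adj-embedˡʳ i j = cong₂ edge (view-embedˡ i) (view-embedʳ j)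

  adj-embedʳˡ : ∀ j i → adj graph (embedʳ j) (embedˡ i) ≡ edge (right j) (left i)
  adj-embedʳˡ j i = cong₂ edge (view-embedʳ j) (view-embedˡ i)

module HubOverBipartite {a b : ℕ} (h : ℕ) (h≤a : h ≤ a) where

  edge : Vertex a b → Vertex a b → Bool
  edge hub       (left i)  = toℕ i <ᵇ h
  edge (left i)  hub       = toℕ i <ᵇ h
  edge (left _)  (right _) = true
  edge (right _) (left _)  = true
  edge _         _         = false

  edge-sym : ∀ x y → edge x y ≡ edge y x
  edge-sym hub       hub       = refl
  edge-sym hub       (left _)  = refl
  edge-sym hub       (right _) = refl
  edge-sym (left _)  hub       = refl
  edge-sym (left _)  (left _)  = refl
  edge-sym (left _)  (right _) = refl
  edge-sym (right _) hub       = refl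
  edge-sym (right _) (left _)  = refl
  edge-sym (right _) (right _) = refl

  edge-irrefl : ∀ x → edge x x ≡ false
  edge-irrefl hub       = refl
  edge-irrefl (left _)  = refl
  edge-irrefl (right _) = refl

  open BlockGraph edge edge-sym edge-irrefl public

  ∑degree : ∑ (degree graph) ≡ (a * b + h) + (a * b + h)
  ∑degree = begin
    ∑ (degree graph)          ≡⟨ ∑degree≡∑ⱽdegreeⱽ ⟩
    ∑ⱽ degreeⱽ                ≡⟨ cong₂ _+_ degree-hub (cong₂ _+_ ∑degree-left ∑degree-right) ⟩
    h + ((h + a * b) + b * a) ≡⟨ rearrange h a b ⟩
    (a * b + h) + (a * b + h) ∎
    where
    open ≡-Reasoning
    degree-hub : degreeⱽ hub ≡ h
    degree-hub = trans (cong₂ _+_ (∑-<ᵇ h h≤a) (sum-replicate-zero b)) (+-identityʳ h)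
    ∑degree-left : ∑ (degreeⱽ ∘ left) ≡ h + a * b
    ∑degree-left = begin
      ∑ (degreeⱽ ∘ left)                                     ≡⟨ sum-cong-≗ {a} degree-left ⟩
      ∑ (λ (i : Fin a) → b2n (toℕ i <ᵇ h) + b)               ≡⟨ ∑-distrib-+ (λ (i : Fin a) → b2n (toℕ i <ᵇ h)) (λ _ → b) ⟩
      ∑ (λ (i : Fin a) → b2n (toℕ i <ᵇ h)) + ∑ {a} (λ _ → b) ≡⟨ cong₂ _+_ (∑-<ᵇ h h≤a) (∑-const a b) ⟩
      h + a * b                                              ∎
      where
      degree-left : ∀ i → degreeⱽ (left i) ≡ b2n (toℕ i <ᵇ h) + b
      degree-left i = cong (b2n (toℕ i <ᵇ h) +_) (cong₂ _+_ (sum-replicate-zero a) (∑-one b))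
    ∑degree-right : ∑ (degreeⱽ ∘ right) ≡ b * a
    ∑degree-right = trans (sum-cong-≗ {b} λ _ → trans (cong₂ _+_ (∑-one a) (sum-replicate-zero b)) (+-identityʳ a))
                          (∑-const b a)
    rearrange : ∀ h a b → h + ((h + a * b) + b * a) ≡ (a * b + h) + (a * b + h)
    rearrange = solve-∀

  edgeCount-graph : edgeCount graph ≡ a * b + h
  edgeCount-graph = m+m≡n+n⇒m≡n (trans (≡-sym (handshake graph)) ∑degree)

  colour : Vertex a b → Bool
  colour (left _) = false
  colour _        = true

  colour-proper : ∀ x y → edge x y ≡ true → colour y ≡ not (colour x)
  colour-proper hub       (left _)  _ = refl
  colour-proper (left _)  hub       _ = refl
  colour-proper (left _)  (right _) _ = refl
  colour-proper (right _) (left _)  _ = refl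

  triangle-free : ¬ Triangle graph
  triangle-free = bipartite⇒triangle-free graph (colour ∘ view) (λ p q → colour-proper (view p) (view q))

  girth₄ : ∀ {i₁ i₂ j₁ j₂} → i₁ ≢ i₂ → j₁ ≢ j₂ → Girth graph 4
  girth₄ {i₁} {i₂} {j₁} {j₂} i₁≢i₂ j₁≢j₂ =
    square⇒cycle₄ graph square , λ _ → triangle-free⇒cycle-length≥4 {G = graph} triangle-free
    where
    square : Square graph
    square = embedˡ i₁ , embedʳ j₁ , embedˡ i₂ , embedʳ j₂ ,
             adj-embedˡʳ i₁ j₁ , adj-embedʳˡ j₁ i₂ , adj-embedˡʳ i₂ j₂ , adj-embedʳˡ j₂ i₁ ,
             i₁≢i₂ ∘ embedˡ-injective , j₁≢j₂ ∘ embedʳ-injective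

matchedBelow : ℕ → ℕ → ℕ → Bool
matchedBelow h x y = (x ≡ᵇ y) ∧ (x <ᵇ h)

matchedBelow-sym : ∀ h x y → matchedBelow h x y ≡ matchedBelow h y x
matchedBelow-sym h       zero    zero    = refl
matchedBelow-sym h       zero    (suc y) = refl
matchedBelow-sym h       (suc x) zero    = refl
matchedBelow-sym zero    (suc x) (suc y) = trans (∧-zeroʳ (x ≡ᵇ y)) (≡-sym (∧-zeroʳ (y ≡ᵇ x)))
matchedBelow-sym (suc h) (suc x) (suc y) = matchedBelow-sym h x y

∑-matchedBelow : ∀ {n} h c → h ≤ n → ∑ {n} (λ i → b2n (matchedBelow h (toℕ i) c)) ≡ b2n (c <ᵇ h)
∑-matchedBelow {n}     zero    c       _         = trans (sum-cong-≗ {n} λ i → cong b2n (∧-zeroʳ (toℕ i ≡ᵇ c))) (sum-replicate-zero n)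
∑-matchedBelow {suc n} (suc h) zero    (s≤s _)   = cong suc (sum-replicate-zero n)
∑-matchedBelow {suc n} (suc h) (suc c) (s≤s h≤n) = ∑-matchedBelow h c h≤n

-- K_{a,b} without the edges left i — right i for i < h, plus a hub joined to those 2h vertices.
module HubOverDeletedMatching {a b : ℕ} (h : ℕ) (h≤a : h ≤ a) (h≤b : h ≤ b) where

  matched : Fin a → Fin b → Bool
  matched i j = matchedBelow h (toℕ i) (toℕ j)

  edge : Vertex a b → Vertex a b → Bool
  edge hub       (left i)  = toℕ i <ᵇ h
  edge hub       (right j) = toℕ j <ᵇ h
  edge (left i)  hub       = toℕ i <ᵇ h
  edge (right j) hub       = toℕ j <ᵇ h
  edge (left i)  (right j) = not (matched i j)
  edge (right j) (left i)  = not (matched i j)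
  edge _         _         = false

  edge-sym : ∀ x y → edge x y ≡ edge y x
  edge-sym hub       hub       = refl
  edge-sym hub       (left _)  = refl
  edge-sym hub       (right _) = refl
  edge-sym (left _)  hub       = refl
  edge-sym (left _)  (left _)  = refl
  edge-sym (left _)  (right _) = refl
  edge-sym (right _) hub       = refl
  edge-sym (right _) (left _)  = refl
  edge-sym (right _) (right _) = refl

  edge-irrefl : ∀ x → edge x x ≡ false
  edge-irrefl hub       = refl
  edge-irrefl (left _)  = refl
  edge-irrefl (right _) = refl

  open BlockGraph edge edge-sym edge-irrefl public

  degree-hub : degreeⱽ hub ≡ h + h
  degree-hub = cong₂ _+_ (∑-<ᵇ h h≤a) (∑-<ᵇ h h≤b)

  degree-left : ∀ i → degreeⱽ (left i) ≡ b
  degree-left i = begin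
    b2n (toℕ i <ᵇ h) + (∑ {a} (λ _ → 0) + ∑ unmatched) ≡⟨ cong (λ z → b2n (toℕ i <ᵇ h) + (z + ∑ unmatched)) (sum-replicate-zero a) ⟩
    b2n (toℕ i <ᵇ h) + ∑ unmatched                     ≡⟨ +-comm (b2n (toℕ i <ᵇ h)) _ ⟩
    ∑ unmatched + b2n (toℕ i <ᵇ h)                     ≡⟨ cong (∑ unmatched +_) ∑matched ⟨
    ∑ unmatched + ∑ (λ j → b2n (matched i j))          ≡⟨ ∑-not+∑ (matched i) ⟩
    b                                                  ∎
    where
    open ≡-Reasoning
    unmatched = λ j → b2n (not (matched i j))
    ∑matched : ∑ (λ j → b2n (matched i j)) ≡ b2n (toℕ i <ᵇ h)
    ∑matched = trans (sum-cong-≗ {b} λ j → cong b2n (matchedBelow-sym h (toℕ i) (toℕ j))) (∑-matchedBelow h (toℕ i) h≤b)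

  degree-right : ∀ j → degreeⱽ (right j) ≡ a
  degree-right j = begin
    b2n (toℕ j <ᵇ h) + (∑ unmatched + ∑ {b} (λ _ → 0)) ≡⟨ cong (λ z → b2n (toℕ j <ᵇ h) + (∑ unmatched + z)) (sum-replicate-zero b) ⟩
    b2n (toℕ j <ᵇ h) + (∑ unmatched + 0)               ≡⟨ cong (b2n (toℕ j <ᵇ h) +_) (+-identityʳ _) ⟩
    b2n (toℕ j <ᵇ h) + ∑ unmatched                     ≡⟨ +-comm (b2n (toℕ j <ᵇ h)) _ ⟩
    ∑ unmatched + b2n (toℕ j <ᵇ h)                     ≡⟨ cong (∑ unmatched +_) (∑-matchedBelow h (toℕ j) h≤a) ⟨
    ∑ unmatched + ∑ (λ i → b2n (matched i j))          ≡⟨ ∑-not+∑ (λ i → matched i j) ⟩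
    a                                                  ∎
    where
    open ≡-Reasoning
    unmatched = λ i → b2n (not (matched i j))

  regular : ∀ {k} → h + h ≡ k → a ≡ k → b ≡ k → Regular k graph
  regular {k} h+h≡k a≡k b≡k p = trans (degree-view p) (degreeⱽ≡k (view p))
    where
    degreeⱽ≡k : ∀ x → degreeⱽ x ≡ k
    degreeⱽ≡k hub       = trans degree-hub h+h≡k
    degreeⱽ≡k (left i)  = trans (degree-left i) b≡k
    degreeⱽ≡k (right j) = trans (degree-right j) a≡k

two-distinct : ∀ {n} → 2 ≤ n → Σ[ i ∈ Fin n ] Σ[ j ∈ Fin n ] i ≢ j
two-distinct (s≤s (s≤s _)) = 0F , 1F , λ ()

∃-regular-graph : ∀ k h → h + h ≡ k → Σ[ G ∈ Graph (suc (2 * k)) ] Regular k G × edgeCount G ≡ k * k + h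
∃-regular-graph k h h+h≡k =
  graph , regular′ , m+m≡n+n⇒m≡n (trans (regular⇒edgeCount graph regular′) (arithmetic k h h+h≡k))
  where
  h≤k : h ≤ k
  h≤k = subst (h ≤_) h+h≡k (m≤m+n h h)
  open HubOverDeletedMatching {k} {k + 0} h h≤k (≤-trans h≤k (m≤m+n k 0))
  regular′ : Regular k graph
  regular′ = regular h+h≡k refl (+-identityʳ k)
  arithmetic : ∀ k h → h + h ≡ k → suc (2 * k) * k ≡ (k * k + h) + (k * k + h)
  arithmetic .(h + h) h refl = identity h
    where
    identity : ∀ h → suc (2 * (h + h)) * (h + h) ≡ ((h + h) * (h + h) + h) + ((h + h) * (h + h) + h)
    identity = solve-∀

∃-girth₄-graph : ∀ k h → h ≤ k → 2 ≤ k → Σ[ G ∈ Graph (suc (2 * k)) ] edgeCount G ≡ k * k + h × Girth G 4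
∃-girth₄-graph k h h≤k 2≤k =
  graph , trans edgeCount-graph (cong (λ m → k * m + h) (+-identityʳ k)) , girth₄ i₁≢i₂ j₁≢j₂
  where
  open HubOverBipartite {k} {k + 0} h h≤k
  i₁≢i₂ = proj₂ (proj₂ (two-distinct 2≤k))
  j₁≢j₂ = proj₂ (proj₂ (two-distinct (≤-trans 2≤k (m≤m+n k 0))))

-- The pentagon

consecutiveMod5 : ℕ → ℕ → Bool
consecutiveMod5 a b = (suc a ≡ᵇ b) ∨ (suc b ≡ᵇ a) ∨ ((a ≡ᵇ 0) ∧ (b ≡ᵇ 4)) ∨ ((a ≡ᵇ 4) ∧ (b ≡ᵇ 0))

C₅ : Graph 5
C₅ = record
  { adj    = λ i j → consecutiveMod5 (toℕ i) (toℕ j)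
  ; sym    = from-yes (all? λ (i : Fin 5) → all? λ (j : Fin 5) →
               consecutiveMod5 (toℕ i) (toℕ j) ≟ᵇ consecutiveMod5 (toℕ j) (toℕ i))
  ; irrefl = from-yes (all? λ (i : Fin 5) → consecutiveMod5 (toℕ i) (toℕ i) ≟ᵇ false)
  }

C₅-regular : Regular 2 C₅
C₅-regular = from-yes (all? λ (i : Fin 5) → degree C₅ i ≟ℕ 2)

C₅-cycle₅ : HasCycle C₅ 5
C₅-cycle₅ = s≤s (s≤s (s≤s z≤n)) , walk , refl ,
  from-yes (all? λ (i : Fin 5) → adj C₅ (walk (inject₁ i)) (walk (fsuc i)) ≟ᵇ true) ,
  from-yes (all? λ (i : Fin 5) → all? λ (j : Fin 5) → (walk (inject₁ i) ≟ walk (inject₁ j)) →-dec (i ≟ j))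
  where
  walk : Fin 6 → Fin 5
  walk 0F = 0F
  walk 1F = 1F
  walk 2F = 2F
  walk 3F = 3F
  walk 4F = 4F
  walk 5F = 0F

C₅-maxGirth : MaxGirth 2 5
C₅-maxGirth =
  (C₅ , (C₅-regular , refl) ,
   C₅-cycle₅ , λ _ → square-free⇒cycle-length≥5 {G = C₅} (from-no (triangle? C₅)) (from-no (square? C₅))) ,
  λ G _ _ girth → cycle-length≤order G (proj₁ girth)

proposition2 : ∀ (k : ℕ) → 2 ≤ k → 2 ∣ k →
    (k ≡ 2 → MaxGirth k 5)
    × (4 ≤ k → MaxGirth k 3)
    × Σ (Graph (suc (2 * k))) (λ G → edgeCount G ≡ k * k + k / 2 × Girth G 4)
proposition2 k 2≤k (divides h k≡h*2) =
  (λ k≡2 → subst (λ k → MaxGirth k 5) (≡-sym k≡2) C₅-maxGirth) ,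
  (λ 4≤k → let 3≤k = ≤-trans (n≤1+n 3) 4≤k
               G , regular , edges = ∃-regular-graph k h h+h≡k
           in (G , (regular , trans edges k*k+h≡k*k+k/2) , regular⇒girth₃ G 3≤k regular) ,
              λ G′ _ (regular′ , _) girth′ → proj₂ girth′ 3 (proj₁ (regular⇒girth₃ G′ 3≤k regular′))) ,
  (let G , edges , girth₄ = ∃-girth₄-graph k h (subst (h ≤_) h+h≡k (m≤m+n h h)) 2≤k
   in G , trans edges k*k+h≡k*k+k/2 , girth₄)
  where
  h+h≡k : h + h ≡ k
  h+h≡k = ≡-sym (trans k≡h*2 (trans (*-comm h 2) (2*k≡k+k h)))
  k*k+h≡k*k+k/2 : k * k + h ≡ k * k + k / 2
  k*k+h≡k*k+k/2 = cong (k * k +_) (≡-sym (trans (cong (_/ 2) k≡h*2) (m*n/n≡m h 2)))
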